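{- Let $n$ and $\alpha$ be positive integers. For any pair $(k,x)$, with $k$ a positive integer and $x=(x_0,x_1,\dots,x_k)$ an integer vector, satisfying the system $$(1+\alpha)x_0\le n,\qquad (x_0+\dots+x_i)(1+x_i)\le n-i\ \ (i=1,\dots,k),\qquad x_1\ge x_2\ge\dots\ge x_k\ge 0,\qquad x_0+\dots+x_k\ge 0,$$ there exists a pair $(k',x')$, with $k'$ a positive integer and $x'=(x'_0,\dots,x'_{k'})$ an integer vector, satisfying the same system (with $k'$ in place of $k$) such that $x'_0=\lfloor n/(1+\alpha)\rfloor$ and $x'_0+\dots+x'_{k'}\ge x_0+\dots+x_k$.
   Context: The entry $x_0$ is allowed to be negative. -}

module Defs where

open import Data.Nat as ℕ using (ℕ; zero; suc)
open import Data.Nat.DivMod using (_/_)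
open import Data.Integer as ℤ using (ℤ; +_; _+_; _*_; _-_; _≤_; 0ℤ; 1ℤ)
open import Data.Fin as Fin using (Fin; zero; suc; toℕ; inject₁)
open import Data.Product using (_×_; Σ)

psum : {m : ℕ} → (Fin m → ℤ) → Fin m → ℤ
psum x zero    = x zero
psum x (suc i) = x zero + psum (λ j → x (suc j)) i

total : {k : ℕ} → (Fin (suc k) → ℤ) → ℤ
total {k} x = psum x (Fin.fromℕ k)

System : (n α k : ℕ) → (Fin (suc k) → ℤ) → Set
System n α k x =
    ((+ (1 ℕ.+ α)) * x zero ≤ + n)
  × ((i : Fin (suc k)) → 1 ℕ.≤ toℕ i →
        psum x i * (1ℤ + x i) ≤ (+ n) - (+ toℕ i))
  × ((i : Fin k) → 1 ℕ.≤ toℕ i → x (suc i) ≤ x (inject₁ i))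
  × ((i : Fin (suc k)) → 1 ℕ.≤ toℕ i → 0ℤ ≤ x i)
  × (0ℤ ≤ total x)

-- Set m = ⌊n/(1+α)⌋, so x₀ ≤ m. Walk along the tail x₁ ≥ x₂ ≥ …: while x₀ + … + x_i ≤ m
-- the entries are absorbed into the new first entry m; at the first i with
-- x₀ + … + x_i > m, x_i is replaced by the excess r = x₀ + … + x_i − m ≤ x_i, which is
-- moved to its place in the nonincreasing order of the remaining entries. Each constraint
-- of the new tail is then dominated by one of the old tail at an index at least as large
-- (with a partial sum and a factor 1 + x_j at least as large), and the total does not
-- drop. If the whole tail is absorbed, (m, 0) is a solution because m ≤ n − 1.
module Submission where

open import Defs
open import Data.Nat as ℕ using (ℕ; zero; suc)
open import Data.Nat.DivMod using (_/_)
open import Data.Integer as ℤ using (ℤ; +_; _≤_)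
open import Data.Fin using (Fin; zero)
open import Relation.Binary.PropositionalEquality using (_≡_)
open import Data.Product using (_×_; Σ; ∃)

open import Data.Fin using (suc; toℕ; inject₁)
open import Data.Integer using (_+_; _*_; _-_; 0ℤ; 1ℤ; -[1+_]; +≤+; -≤+; nonNegative)
import Data.Integer.Properties as ℤP
import Data.Nat.Properties as ℕP
import Data.Nat.DivMod as ℕDM
open import Data.Vec.Functional using (Vector; []; _∷_; head; tail; foldr)
open import Data.Unit using (⊤; tt)
open import Data.Product using (_,_)
open import Relation.Binary.PropositionalEquality
  using (refl; sym; trans; cong; subst; subst₂; module ≡-Reasoning)
open import Relation.Nullary using (yes; no)
open import Algebra.Properties.CommutativeSemigroup ℤP.+-commutativeSemigroup
  using (x∙yz≈y∙xz; xy∙z≈xz∙y)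
open import Data.Integer.Tactic.RingSolver using (solve-∀)

*-mono-≤-nonNeg : ∀ {a b c d} → 0ℤ ≤ b → 0ℤ ≤ c → a ≤ b → c ≤ d → a * c ≤ b * d
*-mono-≤-nonNeg {b = b} {c} 0≤b 0≤c a≤b c≤d = ℤP.≤-trans
  (ℤP.*-monoʳ-≤-nonNeg c {{nonNegative 0≤c}} a≤b)
  (ℤP.*-monoˡ-≤-nonNeg b {{nonNegative 0≤b}} c≤d)

excess : ∀ {B a m} → B ≤ m → m ℤ.< B + a → Σ ℤ λ r → 0ℤ ≤ r × r ≤ a × m + r ≡ B + a
excess {B} {a} {m} B≤m m<B+a = B + a - m , ℤP.i≤j⇒0≤j-i (ℤP.<⇒≤ m<B+a) , r≤a , m+r≡B+a
  where
  r≤a : B + a - m ≤ a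
  r≤a = subst₂ _≤_ (sym (lemma m B a)) (ℤP.+-identityʳ a) (ℤP.+-monoʳ-≤ a (ℤP.i≤j⇒i-j≤0 B≤m))
    where
    lemma : ∀ x y z → y + z - x ≡ z + (y - x)
    lemma = solve-∀
  m+r≡B+a : m + (B + a - m) ≡ B + a
  m+r≡B+a = lemma m B a
    where
    lemma : ∀ x y z → x + (y + z - x) ≡ y + z
    lemma = solve-∀

sum : ∀ {L} → Vector ℤ L → ℤ
sum = foldr _+_ 0ℤ

HeadAtMost : ∀ {L} → ℤ → Vector ℤ L → Set
HeadAtMost {zero}  u a = ⊤
HeadAtMost {suc L} u a = head a ≤ u

Nonincreasing : ∀ {L} → Vector ℤ L → Set
Nonincreasing {zero}  a = ⊤
Nonincreasing {suc L} a = (j : Fin L) → a (suc j) ≤ a (inject₁ j)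

insert : ∀ {L} → ℤ → Vector ℤ L → Vector ℤ (suc L)
insert {zero}  r a = r ∷ a
insert {suc L} r a with head a ℤ.≤? r
... | yes _ = r ∷ a
... | no  _ = head a ∷ insert r (tail a)

sum-insert : ∀ {L} r (a : Vector ℤ L) → sum (insert r a) ≡ r + sum a
sum-insert {zero}  r a = refl
sum-insert {suc L} r a with head a ℤ.≤? r
... | yes _ = refl
... | no  _ = begin
  head a + sum (insert r (tail a)) ≡⟨ cong (λ s → head a + s) (sum-insert r (tail a)) ⟩
  head a + (r + sum (tail a))      ≡⟨ x∙yz≈y∙xz (head a) r (sum (tail a)) ⟩
  r + (head a + sum (tail a))      ∎
  where open ≡-Reasoning

insert-headAtMost : ∀ {L} {u r} (a : Vector ℤ L) → r ≤ u → HeadAtMost u a →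
  HeadAtMost u (insert r a)
insert-headAtMost {zero}          a r≤u _ = r≤u
insert-headAtMost {suc L} {r = r} a r≤u a₀≤u with head a ℤ.≤? r
... | yes _ = r≤u
... | no  _ = a₀≤u

Nonincreasing-head : ∀ {L} (a : Vector ℤ (suc L)) → Nonincreasing a → HeadAtMost (head a) (tail a)
Nonincreasing-head {zero}  a _      = tt
Nonincreasing-head {suc L} a nonincr = nonincr zero

Nonincreasing-tail : ∀ {L} (a : Vector ℤ (suc L)) → Nonincreasing a → Nonincreasing (tail a)
Nonincreasing-tail {zero}  a _       = tt
Nonincreasing-tail {suc L} a nonincr = λ j → nonincr (suc j)

Nonincreasing-∷ : ∀ {L} (a : Vector ℤ (suc L)) →
  HeadAtMost (head a) (tail a) → Nonincreasing (tail a) → Nonincreasing a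
Nonincreasing-∷ {zero}  a _     _       ()
Nonincreasing-∷ {suc L} a a₁≤a₀ _       zero    = a₁≤a₀
Nonincreasing-∷ {suc L} a _     nonincr (suc j) = nonincr j

module _ (n : ℕ) where

  -- Admissible c B a: the entries of a may occupy the positions c+1, c+2, … of a
  -- solution whose earlier entries sum to B.
  Admissible : ∀ {L} → ℕ → ℤ → Vector ℤ L → Set
  Admissible {zero}  c B a = ⊤
  Admissible {suc L} c B a =
      (B + head a) * (1ℤ + head a) ≤ + n - + suc c
    × 0ℤ ≤ head a
    × HeadAtMost (head a) (tail a)
    × Admissible (suc c) (B + head a) (tail a)

  bound-suc : ∀ c → + n - + suc (suc c) ≤ + n - + suc c
  bound-suc c = ℤP.+-monoʳ-≤ (+ n) (ℤP.neg-mono-≤ (+≤+ (ℕP.n≤1+n (suc c))))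

  Admissible-weaken : ∀ {L} {c B} (a : Vector ℤ L) → Admissible (suc c) B a → Admissible c B a
  Admissible-weaken {zero}      a _ = tt
  Admissible-weaken {suc L} {c} a (bound , 0≤a₀ , a₁≤a₀ , rest) =
    ℤP.≤-trans bound (bound-suc c) , 0≤a₀ , a₁≤a₀ , Admissible-weaken (tail a) rest

  insert-admissible : ∀ {L} c B r (a : Vector ℤ L) → 0ℤ ≤ B → 0ℤ ≤ r →
    (B + r) * (1ℤ + r) ≤ + n - + suc c → Admissible (suc c) (B + r) a →
    Admissible c B (insert r a)
  insert-admissible {zero}  c B r a _ 0≤r bound _ = bound , 0≤r , tt , tt
  insert-admissible {suc L} c B r a 0≤B 0≤r bound adm@(a₀-bound , 0≤a₀ , a₁≤a₀ , rest)
    with head a ℤ.≤? r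
  ... | yes a₀≤r = bound , 0≤r , a₀≤r , adm
  ... | no  a₀≰r =
    head-bound , 0≤a₀ , insert-headAtMost (tail a) r≤a₀ a₁≤a₀ ,
    insert-admissible (suc c) (B + a₀) r (tail a) (ℤP.+-mono-≤ 0≤B 0≤a₀) 0≤r r-bound
      (subst (λ s → Admissible (suc (suc c)) s (tail a)) (sym reorder) rest)
    where
    a₀ : ℤ
    a₀ = head a
    r≤a₀ : r ≤ a₀
    r≤a₀ = ℤP.<⇒≤ (ℤP.≰⇒> a₀≰r)
    0≤B+r+a₀ : 0ℤ ≤ B + r + a₀
    0≤B+r+a₀ = ℤP.+-mono-≤ (ℤP.+-mono-≤ 0≤B 0≤r) 0≤a₀
    reorder : B + a₀ + r ≡ B + r + a₀
    reorder = xy∙z≈xz∙y B a₀ r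
    head-bound : (B + a₀) * (1ℤ + a₀) ≤ + n - + suc c
    head-bound = ℤP.≤-trans
      (*-mono-≤-nonNeg 0≤B+r+a₀ (ℤP.+-mono-≤ (+≤+ ℕ.z≤n) 0≤a₀)
        (ℤP.+-monoˡ-≤ a₀ (ℤP.i≤i+j B r {{nonNegative 0≤r}})) ℤP.≤-refl)
      (ℤP.≤-trans a₀-bound (bound-suc c))
    r-bound : (B + a₀ + r) * (1ℤ + r) ≤ + n - + suc (suc c)
    r-bound = subst (λ s → s * (1ℤ + r) ≤ + n - + suc (suc c)) (sym reorder)
      (ℤP.≤-trans
        (*-mono-≤-nonNeg 0≤B+r+a₀ (ℤP.+-mono-≤ (+≤+ ℕ.z≤n) 0≤r)
          ℤP.≤-refl (ℤP.+-monoʳ-≤ 1ℤ r≤a₀))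
        a₀-bound)

  Admissible-rebase : ∀ {L} c B (a : Vector ℤ L) m → B ≤ + m → Admissible c B a →
    Σ ℕ λ L′ → Σ (Vector ℤ L′) λ a′ → Admissible c (+ m) a′ × B + sum a ≤ + m + sum a′
  Admissible-rebase {zero}  c B a m B≤m _ = 0 , [] , tt , ℤP.+-monoˡ-≤ 0ℤ B≤m
  Admissible-rebase {suc L} c B a m B≤m (bound , _ , _ , rest) with B + head a ℤ.≤? + m
  ... | yes B+a₀≤m with Admissible-rebase (suc c) (B + head a) (tail a) m B+a₀≤m rest
  ...   | L′ , a′ , adm′ , sum≤ =
    L′ , a′ , Admissible-weaken a′ adm′ ,
    subst (_≤ + m + sum a′) (ℤP.+-assoc B (head a) (sum (tail a))) sum≤
  Admissible-rebase {suc L} c B a m B≤m (bound , _ , _ , rest) | no B+a₀≰m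
    with excess B≤m (ℤP.≰⇒> B+a₀≰m)
  ... | r , 0≤r , r≤a₀ , m+r≡B+a₀ =
    suc L , insert r (tail a) ,
    insert-admissible c (+ m) r (tail a) (+≤+ ℕ.z≤n) 0≤r r-bound
      (subst (λ s → Admissible (suc c) s (tail a)) (sym m+r≡B+a₀) rest) ,
    ℤP.≤-reflexive (sym sums)
    where
    a₀ : ℤ
    a₀ = head a
    r-bound : (+ m + r) * (1ℤ + r) ≤ + n - + suc c
    r-bound = subst (λ s → s * (1ℤ + r) ≤ + n - + suc c) (sym m+r≡B+a₀)
      (ℤP.≤-trans
        (*-mono-≤-nonNeg (subst (0ℤ ≤_) m+r≡B+a₀ (ℤP.+-mono-≤ (+≤+ ℕ.z≤n) 0≤r))
          (ℤP.+-mono-≤ (+≤+ ℕ.z≤n) 0≤r) ℤP.≤-refl (ℤP.+-monoʳ-≤ 1ℤ r≤a₀))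
        bound)
    sums : + m + sum (insert r (tail a)) ≡ B + (a₀ + sum (tail a))
    sums = begin
      + m + sum (insert r (tail a)) ≡⟨ cong (λ s → + m + s) (sum-insert r (tail a)) ⟩
      + m + (r + sum (tail a))      ≡⟨ sym (ℤP.+-assoc (+ m) r (sum (tail a))) ⟩
      + m + r + sum (tail a)        ≡⟨ cong (λ s → s + sum (tail a)) m+r≡B+a₀ ⟩
      B + a₀ + sum (tail a)         ≡⟨ ℤP.+-assoc B a₀ (sum (tail a)) ⟩
      B + (a₀ + sum (tail a))       ∎
      where open ≡-Reasoning

  Admissible-nonempty : ∀ {L} c B (a : Vector ℤ L) → B ≤ + n - + suc c → Admissible c B a →
    Σ ℕ λ K → Σ (Vector ℤ (suc K)) λ b → Admissible c B b × sum a ≤ sum b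
  Admissible-nonempty {zero}  c B a B≤ _ =
    0 , 0ℤ ∷ [] , (bound , ℤP.≤-refl , tt , tt) , ℤP.≤-refl
    where
    bound : (B + 0ℤ) * 1ℤ ≤ + n - + suc c
    bound = subst (_≤ + n - + suc c) (sym (trans (ℤP.*-identityʳ (B + 0ℤ)) (ℤP.+-identityʳ B))) B≤
  Admissible-nonempty {suc L} c B a _ adm = L , a , adm , ℤP.≤-refl

  TailConditions : ∀ {L} → ℕ → ℤ → Vector ℤ L → Set
  TailConditions c B a =
      (∀ j → (B + psum a j) * (1ℤ + a j) ≤ + n - + suc (c ℕ.+ toℕ j))
    × (∀ j → 0ℤ ≤ a j)
    × Nonincreasing a

  TailConditions⇒Admissible : ∀ {L} c B (a : Vector ℤ L) → TailConditions c B a → Admissible c B a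
  TailConditions⇒Admissible {zero}  c B a _ = tt
  TailConditions⇒Admissible {suc L} c B a (bounded , nonNeg , nonincr) =
    subst (λ i → _ ≤ + n - + suc i) (ℕP.+-identityʳ c) (bounded zero) ,
    nonNeg zero , Nonincreasing-head a nonincr ,
    TailConditions⇒Admissible (suc c) (B + head a) (tail a)
      (bounded′ , (λ j → nonNeg (suc j)) , Nonincreasing-tail a nonincr)
    where
    bounded′ : ∀ j → (B + head a + psum (tail a) j) * (1ℤ + tail a j) ≤ + n - + suc (suc c ℕ.+ toℕ j)
    bounded′ j = subst₂ (λ s i → s * (1ℤ + tail a j) ≤ + n - + suc i)
      (sym (ℤP.+-assoc B (head a) (psum (tail a) j))) (ℕP.+-suc c (toℕ j)) (bounded (suc j))

  Admissible⇒TailConditions : ∀ {L} c B (a : Vector ℤ L) → Admissible c B a → TailConditions c B a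
  Admissible⇒TailConditions {zero}  c B a _ = (λ ()) , (λ ()) , tt
  Admissible⇒TailConditions {suc L} c B a (bound , 0≤a₀ , a₁≤a₀ , rest)
    with Admissible⇒TailConditions (suc c) (B + head a) (tail a) rest
  ... | bounded′ , nonNeg′ , nonincr′ = bounded , nonNeg , Nonincreasing-∷ a a₁≤a₀ nonincr′
    where
    bounded : ∀ j → (B + psum a j) * (1ℤ + a j) ≤ + n - + suc (c ℕ.+ toℕ j)
    bounded zero    = subst (λ i → _ ≤ + n - + suc i) (sym (ℕP.+-identityʳ c)) bound
    bounded (suc j) = subst₂ (λ s i → s * (1ℤ + tail a j) ≤ + n - + suc i)
      (ℤP.+-assoc B (head a) (psum (tail a) j)) (sym (ℕP.+-suc c (toℕ j))) (bounded′ j)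
    nonNeg : ∀ j → 0ℤ ≤ a j
    nonNeg zero    = 0≤a₀
    nonNeg (suc j) = nonNeg′ j

System⇒TailConditions : ∀ n α k (x : Vector ℤ (suc k)) → System n α k x →
  TailConditions n 0 (head x) (tail x)
System⇒TailConditions n α k x (_ , bounded , nonincr , nonNeg , _) =
  (λ j → bounded (suc j) (ℕ.s≤s ℕ.z≤n)) , (λ j → nonNeg (suc j) (ℕ.s≤s ℕ.z≤n)) , tail-nonincr k {x} nonincr
  where
  tail-nonincr : ∀ k {x : Vector ℤ (suc k)} →
    ((i : Fin k) → 1 ℕ.≤ toℕ i → x (suc i) ≤ x (inject₁ i)) → Nonincreasing (tail x)
  tail-nonincr zero    _       = tt
  tail-nonincr (suc k) nonincr = λ j → nonincr (suc j) (ℕ.s≤s ℕ.z≤n)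

TailConditions⇒System : ∀ n α k (x : Vector ℤ (suc k)) → + suc α * head x ≤ + n →
  TailConditions n 0 (head x) (tail x) → 0ℤ ≤ total x → System n α k x
TailConditions⇒System n α k x x₀-bound (bounded , nonNeg , nonincr) 0≤total =
  x₀-bound , bounded′ , nonincr′ , nonNeg′ , 0≤total
  where
  bounded′ : (i : Fin (suc k)) → 1 ℕ.≤ toℕ i → psum x i * (1ℤ + x i) ≤ + n - + toℕ i
  bounded′ (suc j) _ = bounded j
  nonincr′ : (i : Fin k) → 1 ℕ.≤ toℕ i → x (suc i) ≤ x (inject₁ i)
  nonincr′ (suc j) _ = nonincr j
  nonNeg′ : (i : Fin (suc k)) → 1 ℕ.≤ toℕ i → 0ℤ ≤ x i
  nonNeg′ (suc j) _ = nonNeg j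

[1+d]*x≤n⇒x≤n/[1+d] : ∀ n d x → + suc d * x ≤ + n → x ≤ + (n / suc d)
[1+d]*x≤n⇒x≤n/[1+d] n d -[1+ _ ] _ = -≤+
[1+d]*x≤n⇒x≤n/[1+d] n d (+ x) dx≤n = +≤+ (begin
  x                    ≡⟨ sym (ℕDM.m*n/n≡m x (suc d)) ⟩
  x ℕ.* suc d / suc d  ≤⟨ ℕDM./-monoˡ-≤ (suc d) (subst (ℕ._≤ n) (ℕP.*-comm (suc d) x) dx≤n′) ⟩
  n / suc d            ∎)
  where
  open ℕP.≤-Reasoning
  dx≤n′ : suc d ℕ.* x ℕ.≤ n
  dx≤n′ = ℤP.drop‿+≤+ (subst (_≤ + n) (sym (ℤP.pos-* (suc d) x)) dx≤n)

[1+d]*[n/[1+d]]≤n : ∀ n d → + suc d * + (n / suc d) ≤ + n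
[1+d]*[n/[1+d]]≤n n d = subst (_≤ + n) (ℤP.pos-* (suc d) (n / suc d))
  (+≤+ (subst (ℕ._≤ n) (ℕP.*-comm (n / suc d) (suc d)) (ℕDM.m/n*n≤m n (suc d))))

n/[1+d]≤n-1 : ∀ n d → 1 ℕ.≤ n → 1 ℕ.≤ d → + (n / suc d) ≤ + n - + 1
n/[1+d]≤n-1 (suc n) d _ 1≤d = subst (+ (suc n / suc d) ≤_) n≡[1+n]-1
  (+≤+ (ℕP.<⇒≤pred (ℕDM.m/n<m (suc n) (suc d) (ℕ.s≤s 1≤d))))
  where
  n≡[1+n]-1 : + n ≡ + suc n - + 1
  n≡[1+n]-1 = sym (trans (ℤP.m-n≡m⊖n (suc n) 1) (ℤP.⊖-≥ (ℕ.s≤s ℕ.z≤n)))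

total≡head+sum : ∀ k (x : Vector ℤ (suc k)) → total x ≡ head x + sum (tail x)
total≡head+sum zero    x = sym (ℤP.+-identityʳ (head x))
total≡head+sum (suc k) x = cong (λ s → head x + s) (total≡head+sum k (tail x))

proposition1 : (n α : ℕ) → 1 ℕ.≤ n → 1 ℕ.≤ α →
    (k : ℕ) → 1 ℕ.≤ k → (x : Fin (suc k) → ℤ) → System n α k x →
    Σ ℕ λ k′ → Σ (Fin (suc k′) → ℤ) λ x′ →
      (1 ℕ.≤ k′) × System n α k′ x′
      × (x′ zero ≡ + (n / suc α)) × (total x ℤ.≤ total x′)
proposition1 n α 1≤n 1≤α k _ x sys@(x₀-bound , _ , _ , _ , 0≤total)
  with Admissible-rebase n 0 (head x) (tail x) (n / suc α) ([1+d]*x≤n⇒x≤n/[1+d] n α (head x) x₀-bound)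
         (TailConditions⇒Admissible n 0 (head x) (tail x) (System⇒TailConditions n α k x sys))
... | L , a , adm , rebased≤ with Admissible-nonempty n 0 (+ (n / suc α)) a (n/[1+d]≤n-1 n α 1≤n 1≤α) adm
... | K , b , adm′ , padded≤ =
  suc K , x′ , ℕ.s≤s ℕ.z≤n ,
  TailConditions⇒System n α (suc K) x′ ([1+d]*[n/[1+d]]≤n n α)
    (Admissible⇒TailConditions n 0 (head x′) b adm′) (ℤP.≤-trans 0≤total increase) ,
  refl , increase
  where
  x′ : Vector ℤ (suc (suc K))
  x′ = + (n / suc α) ∷ b
  increase : total x ≤ total x′
  increase = begin
    total x                     ≡⟨ total≡head+sum k x ⟩
    head x + sum (tail x)       ≤⟨ rebased≤ ⟩
    + (n / suc α) + sum a       ≤⟨ ℤP.+-monoʳ-≤ (+ (n / suc α)) padded≤ ⟩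
    + (n / suc α) + sum b       ≡⟨ sym (total≡head+sum (suc K) x′) ⟩
    total x′                    ∎
    where open ℤP.≤-Reasoning
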